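{- Let $\alpha\ge 0$. Let $T^*$ be an $n$-vertex tournament and $\pi$ a permutation of $V(T^*)$ such that $|E(T^*_L(\pi))|\le \alpha n^2$. Then ${\rm inv}_3(T^*)\le \alpha n^2/2+o(n^2)$, where the $o(n^2)$ term depends only on $n$.
   Context: For a digraph $D$ and a permutation $\pi$ of $V(D)$, $D_L(\pi)$ is the undirected simple graph on $V(D)$ in which $\{i,j\}$ is an edge iff $(i,j)\in E(D)$ and $\pi(i)<\pi(j)$. Inverting $X\subseteq V(D)$ means reversing the direction of every edge with both endpoints in $X$. ${\rm inv}_3(D)$ is the minimum number of sets, each of size at most $3$, whose successive inversion makes $D$ acyclic.
   Formalization: The parameter α ranges over the nonnegative rationals. -}

module Defs where

open import Data.Bool using (Bool; true; false; _∧_; _∨_; if_then_else_)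
open import Data.Nat as ℕ using (ℕ; _<ᵇ_)
open import Data.Integer using (+_)
open import Data.Fin using (Fin; toℕ)
open import Data.Fin.Subset using (Subset)
open import Data.Fin.Permutation using (Permutation′; _⟨$⟩ʳ_)
open import Data.List using (List; []; _∷_; map; allFin; foldl)
open import Data.Nat.ListAction using (sum)
open import Data.Vec using (lookup)
open import Data.Product using (∃; _×_)
open import Data.Rational using (ℚ; _/_; _≤_; _*_; Positive)
open import Relation.Binary.PropositionalEquality using (_≡_; _≢_)
open import Relation.Binary.Construct.Closure.Transitive using (TransClosure)
open import Relation.Nullary using (¬_)

Digraph : ℕ → Set
Digraph n = Fin n → Fin n → Bool

IsTournament : ∀ {n} → Digraph n → Set
IsTournament {n} D =
  (∀ (i : Fin n) → D i i ≡ false) ×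
  (∀ (i j : Fin n) → i ≢ j → ((D i j ≡ true) × (D j i ≡ false)) Data.Sum.⊎ ((D i j ≡ false) × (D j i ≡ true)))
  where import Data.Sum

ℕtoℚ : ℕ → ℚ
ℕtoℚ k = + k / 1

-- {i,j} is an edge of D_L(π)  (for unordered pair i, j)
LEdge : ∀ {n} → Digraph n → Permutation′ n → Fin n → Fin n → Bool
LEdge D π i j =
  (D i j ∧ (toℕ (π ⟨$⟩ʳ i) <ᵇ toℕ (π ⟨$⟩ʳ j))) ∨
  (D j i ∧ (toℕ (π ⟨$⟩ʳ j) <ᵇ toℕ (π ⟨$⟩ʳ i)))

numLEdges : ∀ {n} → Digraph n → Permutation′ n → ℕ
numLEdges {n} D π =
  sum (map (λ i → sum (map (λ j → if (toℕ i <ᵇ toℕ j) ∧ LEdge D π i j then 1 else 0)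
                           (allFin n)))
           (allFin n))

invert : ∀ {n} → Subset n → Digraph n → Digraph n
invert X D i j = if lookup X i ∧ lookup X j then D j i else D i j

invertAll : ∀ {n} → List (Subset n) → Digraph n → Digraph n
invertAll Xs D = foldl (λ D' X → invert X D') D Xs

Acyclic : ∀ {n} → Digraph n → Set
Acyclic {n} D = ∀ (i : Fin n) → ¬ TransClosure (λ a b → D a b ≡ true) i i

LittleOSq : (ℕ → ℕ) → Set
LittleOSq f = ∀ (ε : ℚ) → Positive ε →
  ∃ λ (N : ℕ) → ∀ (n : ℕ) → N ℕ.≤ n → ℕtoℚ (f n) ≤ ε * ℕtoℚ (n ℕ.* n)

-- Call an edge of T an L-edge when it points from an earlier to a later vertex in the order π. Inverting a list of
-- sets reverses a pair exactly when an odd number of the sets contain it. Cut the vertex set into blocks of k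
-- consecutive vertices. For each vertex i, run through its larger L-neighbours in increasing order: two
-- consecutive ones a, b in the same block are reversed together by inverting {i, a, b}, whose side effect on the
-- pair {a, b} stays inside a block, and every other one by inverting {i, a}, which is needed at most once per
-- change of block. This reverses all L-edges between different blocks with at most (|E(T_L(π))| + n (n/k + 1))/2
-- sets. The at most n k L-edges left inside blocks are reversed one at a time, by the same construction with
-- singleton blocks. Then every edge points backwards along π, so the tournament is acyclic, and k = ⌊√n⌋ + 1
-- makes the overhead O(n^{3/2}).

module Submission where

module TournamentInversion where
  open import Algebra using (CommutativeRing)
  import Algebra.Properties.CommutativeSemigroup as CommSemigroupProps
  open import Data.Bool using (Bool; true; false; _∧_; _∨_; _xor_; if_then_else_; T)
  open import Data.Bool.Properties
    using (∨-comm; ∧-comm; ∧-zeroʳ; ∧-identityʳ; ∧-distribˡ-xor; xor-identityʳ; xor-same; xor-assoc;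
           xor-∧-commutativeRing)
  open import Data.Empty using (⊥)
  open import Data.Fin as Fin using (Fin; zero; suc; toℕ)
  open import Data.Fin.Permutation using (Permutation′; _⟨$⟩ʳ_; _⟨$⟩ˡ_; inverseˡ)
  open import Data.Fin.Properties using (_≟_; toℕ-injective; toℕ<n) renaming (<-trans to <ᶠ-trans)
  open import Data.Fin.Subset using (Subset; ⁅_⁆; _∪_; ∣_∣)
  open import Data.Fin.Subset.Properties using (∣⁅x⁆∣≡1)
  import Data.Integer as ℤ
  open import Data.Integer.Properties using (pos-+; pos-*) renaming (*-identityʳ to ℤ-*-identityʳ)
  open import Data.Integer.Tactic.RingSolver renaming (solve-∀ to ℤ-solve-∀)
  open import Data.List using (List; []; _∷_; _++_; foldr; map; concatMap; allFin; length; filterᵇ)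
  open import Data.List.Properties using (foldl-++; map-tabulate; map-cong; length-++; length-tabulate)
  open import Data.List.Relation.Unary.All as All using (All; []; _∷_)
  open import Data.List.Relation.Unary.All.Properties
    using (all-filter; concat⁺; ++⁺) renaming (map⁺ to All-map⁺)
  open import Data.List.Relation.Unary.AllPairs using (AllPairs; []; _∷_)
  open import Data.List.Relation.Unary.AllPairs.Properties using (tabulate⁺-<)
  open import Data.List.Relation.Unary.Linked as Linked using (Linked; []; [-]; _∷_)
  open import Data.List.Relation.Unary.Linked.Properties
    using (AllPairs⇒Linked; Linked⇒AllPairs) renaming (filter⁺ to Linked-filter⁺)
  open import Data.Nat as ℕ using (ℕ; _<ᵇ_; _+_; _*_; _∸_; _≤_; _<_; z≤n; s≤s; NonZero)
  open import Data.Nat.Coprimality using (Coprime)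
  open import Data.Nat.DivMod using (_/_; _%_; m/n*n≤m; m≡m%n+[m/n]*n; m%n<n; /-monoˡ-≤; m<n*o⇒m/o<n)
  open import Data.Nat.ListAction using (sum)
  open import Data.Nat.Properties
    using (_<?_; ≡ᵇ⇒≡; ≡⇒≡ᵇ; <-cmp; ≤-refl; ≤-reflexive; ≤-trans; <-irrefl; <-trans; <⇒≤; ≤∧≢⇒<; ≰⇒>; ≮⇒≥;
           <⇒≱; n≤1+n; n<1+n; m≤n⇒m≤1+n; m≤m+n; m≤n*m; +-comm; +-assoc; +-suc; +-commutativeSemigroup;
           +-mono-≤; +-monoˡ-≤; +-monoʳ-≤; +-monoˡ-<; *-identityʳ; *-mono-<; *-mono-≤; *-monoˡ-≤; *-monoʳ-≤;
           +-∸-assoc; ∸-monoʳ-≤; m+n∸m≡n; module ≤-Reasoning)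
  open import Data.Nat.Tactic.RingSolver using (solve-∀)
  open import Data.Product using (∃; _×_; _,_; proj₁; proj₂)
  open import Data.Rational using (ℚ; ½; mkℚ; toℚᵘ) renaming (_+_ to _+ℚ_; _*_ to _*ℚ_; _≤_ to _≤ℚ_)
  open import Data.Rational.Properties using (toℚᵘ-cancel-≤; toℚᵘ-fromℚᵘ; toℚᵘ-homo-+; toℚᵘ-homo-*)
  open import Data.Rational.Unnormalised using (ℚᵘ; mkℚᵘ; *≤*) renaming (_≤_ to _≤ᵘ_; _≃_ to _≃ᵘ_)
  import Data.Rational.Unnormalised.Properties as ℚᵘ
  open import Data.Sum using (_⊎_; inj₁; inj₂)
  open import Data.Vec using (lookup; []; _∷_)
  open import Data.Vec.Properties using (lookup-zipWith; lookup-replicate)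
  open import Defs
  open import Function using (_∘_)
  open import Relation.Binary using (tri<; tri≈; tri>)
  open import Relation.Binary.Construct.Closure.Transitive using (TransClosure; [_]; _∷_)
  open import Relation.Binary.PropositionalEquality
  open import Relation.Nullary using (does; yes; no; contradiction)
  open import Relation.Nullary.Decidable using (dec-true; dec-false; T?)

  private variable
    n : ℕ
    A B : Set

  open CommSemigroupProps (CommutativeRing.+-commutativeSemigroup xor-∧-commutativeRing)
    using () renaming (interchange to xor-interchange)
  open CommSemigroupProps +-commutativeSemigroup using () renaming (interchange to +-interchange)

  xorSum : (A → Bool) → List A → Bool
  xorSum f = foldr (λ a b → f a xor b) false

  xorSum-++ : (f : A → Bool) (l m : List A) → xorSum f (l ++ m) ≡ xorSum f l xor xorSum f m
  xorSum-++ f []      m = refl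
  xorSum-++ f (a ∷ l) m = trans (cong (f a xor_) (xorSum-++ f l m)) (sym (xor-assoc (f a) _ _))

  xorSum-concatMap : (f : B → Bool) (g : A → List B) (l : List A) →
                     xorSum f (concatMap g l) ≡ xorSum (xorSum f ∘ g) l
  xorSum-concatMap f g []      = refl
  xorSum-concatMap f g (a ∷ l) =
    trans (xorSum-++ f (g a) (concatMap g l)) (cong (xorSum f (g a) xor_) (xorSum-concatMap f g l))

  xorSum-cong : {f g : A → Bool} → (∀ a → f a ≡ g a) → (l : List A) → xorSum f l ≡ xorSum g l
  xorSum-cong f≗g []      = refl
  xorSum-cong f≗g (a ∷ l) = cong₂ _xor_ (f≗g a) (xorSum-cong f≗g l)

  xorSum-xor : (f g : A → Bool) (l : List A) →
               xorSum (λ a → f a xor g a) l ≡ xorSum f l xor xorSum g l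
  xorSum-xor f g []      = refl
  xorSum-xor f g (a ∷ l) =
    trans (cong ((f a xor g a) xor_) (xorSum-xor f g l)) (xor-interchange (f a) (g a) _ _)

  xorSum-∧ˡ : (x : Bool) (f : A → Bool) (l : List A) → xorSum (λ a → x ∧ f a) l ≡ x ∧ xorSum f l
  xorSum-∧ˡ x f []      = sym (∧-zeroʳ x)
  xorSum-∧ˡ x f (a ∷ l) =
    trans (cong ((x ∧ f a) xor_) (xorSum-∧ˡ x f l)) (sym (∧-distribˡ-xor x (f a) _))

  xorSum-filterᵇ : (p f : A → Bool) (l : List A) → xorSum f (filterᵇ p l) ≡ xorSum (λ a → p a ∧ f a) l
  xorSum-filterᵇ p f []      = refl
  xorSum-filterᵇ p f (a ∷ l) with p a
  ... | true  = cong (f a xor_) (xorSum-filterᵇ p f l)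
  ... | false = xorSum-filterᵇ p f l

  xorSum-map : (f : B → Bool) (g : A → B) (l : List A) → xorSum f (map g l) ≡ xorSum (f ∘ g) l
  xorSum-map f g []      = refl
  xorSum-map f g (a ∷ l) = cong (f (g a) xor_) (xorSum-map f g l)

  _=ᵇ_ : Fin n → Fin n → Bool
  a =ᵇ b = does (a ≟ b)

  xorSum-indicator : (u : Fin n) (Q : Fin n → Bool) → xorSum (λ i → (u =ᵇ i) ∧ Q i) (allFin n) ≡ Q u
  xorSum-indicator {ℕ.suc n} u Q = begin
    xorSum R (allFin (ℕ.suc n))                      ≡⟨ cong (λ l → R zero xor xorSum R l) (sym (map-tabulate (λ i → i) suc)) ⟩
    R zero xor xorSum R (map suc (allFin n))         ≡⟨ cong (R zero xor_) (xorSum-map R suc (allFin n)) ⟩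
    R zero xor xorSum (R ∘ suc) (allFin n)           ≡⟨ shift u ⟩
    Q u                                              ∎
    where
    open ≡-Reasoning
    R : Fin (ℕ.suc n) → Bool
    R i = (u =ᵇ i) ∧ Q i
    shift : (u : Fin (ℕ.suc n)) → ((u =ᵇ zero) ∧ Q zero) xor xorSum (λ i → (u =ᵇ suc i) ∧ Q (suc i)) (allFin n) ≡ Q u
    shift zero    = trans (cong (Q zero xor_) (xorSum-∧ˡ false (Q ∘ suc) (allFin n))) (xor-identityʳ (Q zero))
    shift (suc u) = xorSum-indicator u (Q ∘ suc)

  length-allFin : length (allFin n) ≡ n
  length-allFin = length-tabulate (λ i → i)

  length-filterᵇ : (p : A → Bool) (l : List A) → length (filterᵇ p l) ≡ sum (map (λ a → if p a then 1 else 0) l)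
  length-filterᵇ p []      = refl
  length-filterᵇ p (a ∷ l) with p a
  ... | true  = cong ℕ.suc (length-filterᵇ p l)
  ... | false = length-filterᵇ p l

  length-concatMap : (g : A → List B) (l : List A) → length (concatMap g l) ≡ sum (map (length ∘ g) l)
  length-concatMap g []      = refl
  length-concatMap g (a ∷ l) = trans (length-++ (g a)) (cong (length (g a) +_) (length-concatMap g l))

  sum-map-mono : {f g : A → ℕ} → (∀ a → f a ≤ g a) → (l : List A) → sum (map f l) ≤ sum (map g l)
  sum-map-mono f≤g []      = z≤n
  sum-map-mono f≤g (a ∷ l) = +-mono-≤ (f≤g a) (sum-map-mono f≤g l)

  sum-map-+ : (f g : A → ℕ) (l : List A) → sum (map (λ a → f a + g a) l) ≡ sum (map f l) + sum (map g l)
  sum-map-+ f g []      = refl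
  sum-map-+ f g (a ∷ l) = trans (cong (f a + g a +_) (sum-map-+ f g l)) (+-interchange (f a) (g a) _ _)

  sum-map-const : (c : ℕ) (l : List A) → sum (map (λ _ → c) l) ≡ length l * c
  sum-map-const c []      = refl
  sum-map-const c (a ∷ l) = cong (c +_) (sum-map-const c l)

  length-increasing≤ : (f : A → ℕ) {lo hi : ℕ} {l : List A} → AllPairs (λ x y → f x < f y) l →
                       All (λ x → lo ≤ f x) l → All (λ x → f x < hi) l → length l ≤ hi ∸ lo
  length-increasing≤ f []            []             []             = z≤n
  length-increasing≤ f {lo} {hi} {x ∷ xs} (x<xs ∷ xs↑) (lo≤x ∷ _) (x<hi ∷ xs<hi) = begin
    ℕ.suc (length xs)       ≤⟨ s≤s (length-increasing≤ f xs↑ x<xs xs<hi) ⟩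
    ℕ.suc (hi ∸ ℕ.suc (f x)) ≡⟨ +-∸-assoc 1 x<hi ⟨
    hi ∸ f x                ≤⟨ ∸-monoʳ-≤ hi lo≤x ⟩
    hi ∸ lo                 ∎
    where open ≤-Reasoning

  ≡ᵇ≡true⇒≡ : {m k : ℕ} → (m ℕ.≡ᵇ k) ≡ true → m ≡ k
  ≡ᵇ≡true⇒≡ {m} {k} eq = ≡ᵇ⇒≡ m k (subst T (sym eq) _)

  ≡ᵇ≡false⇒≢ : {m k : ℕ} → (m ℕ.≡ᵇ k) ≡ false → m ≢ k
  ≡ᵇ≡false⇒≢ {m} {k} eq m≡k = subst T eq (≡⇒≡ᵇ m k m≡k)

  lookup-⁅⁆ : (y x : Fin n) → lookup ⁅ y ⁆ x ≡ (x =ᵇ y)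
  lookup-⁅⁆ zero    zero    = refl
  lookup-⁅⁆ zero    (suc x) = lookup-replicate x false
  lookup-⁅⁆ (suc y) zero    = refl
  lookup-⁅⁆ (suc y) (suc x) = lookup-⁅⁆ y x

  lookup-∪ : (p q : Subset n) (x : Fin n) → lookup (p ∪ q) x ≡ lookup p x ∨ lookup q x
  lookup-∪ p q x = lookup-zipWith _∨_ x p q

  ∣p∪q∣≤∣p∣+∣q∣ : (p q : Subset n) → ∣ p ∪ q ∣ ≤ ∣ p ∣ + ∣ q ∣
  ∣p∪q∣≤∣p∣+∣q∣ []          []          = z≤n
  ∣p∪q∣≤∣p∣+∣q∣ (true  ∷ p) (true  ∷ q) = s≤s (≤-trans (∣p∪q∣≤∣p∣+∣q∣ p q) (+-monoʳ-≤ ∣ p ∣ (n≤1+n ∣ q ∣)))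
  ∣p∪q∣≤∣p∣+∣q∣ (true  ∷ p) (false ∷ q) = s≤s (∣p∪q∣≤∣p∣+∣q∣ p q)
  ∣p∪q∣≤∣p∣+∣q∣ (false ∷ p) (true  ∷ q) = ≤-trans (s≤s (∣p∪q∣≤∣p∣+∣q∣ p q)) (≤-reflexive (sym (+-suc ∣ p ∣ ∣ q ∣)))
  ∣p∪q∣≤∣p∣+∣q∣ (false ∷ p) (false ∷ q) = ∣p∪q∣≤∣p∣+∣q∣ p q

  ∣⁅i⁆∪⁅a⁆∣≤3 : (i a : Fin n) → ∣ ⁅ i ⁆ ∪ ⁅ a ⁆ ∣ ≤ 3
  ∣⁅i⁆∪⁅a⁆∣≤3 i a = ≤-trans (∣p∪q∣≤∣p∣+∣q∣ ⁅ i ⁆ ⁅ a ⁆)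
    (≤-trans (≤-reflexive (cong₂ _+_ (∣⁅x⁆∣≡1 i) (∣⁅x⁆∣≡1 a))) (n≤1+n 2))

  ∣⁅i⁆∪⁅a⁆∪⁅b⁆∣≤3 : (i a b : Fin n) → ∣ ⁅ i ⁆ ∪ ⁅ a ⁆ ∪ ⁅ b ⁆ ∣ ≤ 3
  ∣⁅i⁆∪⁅a⁆∪⁅b⁆∣≤3 i a b = ≤-trans (∣p∪q∣≤∣p∣+∣q∣ ⁅ i ⁆ (⁅ a ⁆ ∪ ⁅ b ⁆))
    (≤-trans (+-monoʳ-≤ ∣ ⁅ i ⁆ ∣ (∣p∪q∣≤∣p∣+∣q∣ ⁅ a ⁆ ⁅ b ⁆))
             (≤-reflexive (cong₂ _+_ (∣⁅x⁆∣≡1 i) (cong₂ _+_ (∣⁅x⁆∣≡1 a) (∣⁅x⁆∣≡1 b)))))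

  =ᵇ∧=ᵇ≡false : {u a v b : Fin n} → (u ≡ a → v ≡ b → ⊥) → (u =ᵇ a) ∧ (v =ᵇ b) ≡ false
  =ᵇ∧=ᵇ≡false {u = u} {a} {v} {b} ¬both with u ≟ a
  ... | no  _    = refl
  ... | yes u≡a = dec-false (v ≟ b) (¬both u≡a)

  ∨-disjoint : ∀ x y → x ∧ y ≡ false → x ∨ y ≡ x xor y
  ∨-disjoint true  true  ()
  ∨-disjoint true  false _ = refl
  ∨-disjoint false y     _ = refl

  ∨-∧-∨-disjoint : ∀ x y a b → x ∧ y ≡ false → a ∧ b ≡ false → (x ∨ a) ∧ (y ∨ b) ≡ (x ∧ b) xor (y ∧ a)
  ∨-∧-∨-disjoint true  true  a b () _
  ∨-∧-∨-disjoint true  false a b _  _   = sym (xor-identityʳ b)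
  ∨-∧-∨-disjoint false true  a b _  _   = ∧-identityʳ a
  ∨-∧-∨-disjoint false false a b _  a∧b = a∧b

  covers : Subset n → Fin n → Fin n → Bool
  covers X u v = lookup X u ∧ lookup X v

  covers-∪ : (p q : Subset n) (u v : Fin n) → covers p u v ≡ false → covers q u v ≡ false →
             covers (p ∪ q) u v ≡ (lookup p u ∧ lookup q v) xor (lookup p v ∧ lookup q u)
  covers-∪ p q u v p∌uv q∌uv rewrite lookup-∪ p q u | lookup-∪ p q v =
    ∨-∧-∨-disjoint (lookup p u) (lookup p v) (lookup q u) (lookup q v) p∌uv q∌uv

  covers-⁅⁆ : {u v : Fin n} → u ≢ v → (i : Fin n) → covers ⁅ i ⁆ u v ≡ false
  covers-⁅⁆ {u = u} {v} u≢v i rewrite lookup-⁅⁆ i u | lookup-⁅⁆ i v =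
    =ᵇ∧=ᵇ≡false (λ u≡i v≡i → u≢v (trans u≡i (sym v≡i)))

  -- samePair i a u v holds iff {u, v} = {i, a}, provided u ≢ v.
  samePair : Fin n → Fin n → Fin n → Fin n → Bool
  samePair i a u v = ((u =ᵇ i) ∧ (v =ᵇ a)) xor ((v =ᵇ i) ∧ (u =ᵇ a))

  covers-pair : {u v : Fin n} → u ≢ v → (i a : Fin n) → covers (⁅ i ⁆ ∪ ⁅ a ⁆) u v ≡ samePair i a u v
  covers-pair {u = u} {v} u≢v i a rewrite covers-∪ ⁅ i ⁆ ⁅ a ⁆ u v (covers-⁅⁆ u≢v i) (covers-⁅⁆ u≢v a)
    | lookup-⁅⁆ i u | lookup-⁅⁆ i v | lookup-⁅⁆ a u | lookup-⁅⁆ a v = refl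

  covers-triple : {u v : Fin n} → u ≢ v → (i : Fin n) {a b : Fin n} → a ≢ b →
                  covers (⁅ a ⁆ ∪ ⁅ b ⁆) u v ≡ false →
                  covers (⁅ i ⁆ ∪ ⁅ a ⁆ ∪ ⁅ b ⁆) u v ≡ samePair i a u v xor samePair i b u v
  covers-triple {u = u} {v} u≢v i {a} {b} a≢b ab∌uv = begin
    covers (⁅ i ⁆ ∪ ⁅ a ⁆ ∪ ⁅ b ⁆) u v
      ≡⟨ covers-∪ ⁅ i ⁆ (⁅ a ⁆ ∪ ⁅ b ⁆) u v (covers-⁅⁆ u≢v i) ab∌uv ⟩
    (lookup ⁅ i ⁆ u ∧ lookup (⁅ a ⁆ ∪ ⁅ b ⁆) v) xor (lookup ⁅ i ⁆ v ∧ lookup (⁅ a ⁆ ∪ ⁅ b ⁆) u)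
      ≡⟨ cong₂ (λ x y → x xor y) (cong₂ _∧_ (lookup-⁅⁆ i u) (in-ab v)) (cong₂ _∧_ (lookup-⁅⁆ i v) (in-ab u)) ⟩
    ((u =ᵇ i) ∧ ((v =ᵇ a) xor (v =ᵇ b))) xor ((v =ᵇ i) ∧ ((u =ᵇ a) xor (u =ᵇ b)))
      ≡⟨ cong₂ _xor_ (∧-distribˡ-xor (u =ᵇ i) _ _) (∧-distribˡ-xor (v =ᵇ i) _ _) ⟩
    (((u =ᵇ i) ∧ (v =ᵇ a)) xor ((u =ᵇ i) ∧ (v =ᵇ b))) xor (((v =ᵇ i) ∧ (u =ᵇ a)) xor ((v =ᵇ i) ∧ (u =ᵇ b)))
      ≡⟨ xor-interchange ((u =ᵇ i) ∧ (v =ᵇ a)) ((u =ᵇ i) ∧ (v =ᵇ b)) ((v =ᵇ i) ∧ (u =ᵇ a)) _ ⟩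
    samePair i a u v xor samePair i b u v
      ∎
    where
    open ≡-Reasoning
    in-ab : (x : Fin _) → lookup (⁅ a ⁆ ∪ ⁅ b ⁆) x ≡ (x =ᵇ a) xor (x =ᵇ b)
    in-ab x rewrite lookup-∪ ⁅ a ⁆ ⁅ b ⁆ x | lookup-⁅⁆ a x | lookup-⁅⁆ b x =
      ∨-disjoint (x =ᵇ a) (x =ᵇ b) (=ᵇ∧=ᵇ≡false {u = x} {v = x} λ x≡a x≡b → a≢b (trans (sym x≡a) x≡b))

  coverParity : List (Subset n) → Fin n → Fin n → Bool
  coverParity Xs u v = xorSum (λ X → covers X u v) Xs

  coverParity-sym : (Xs : List (Subset n)) (u v : Fin n) → coverParity Xs u v ≡ coverParity Xs v u
  coverParity-sym Xs u v = xorSum-cong (λ X → ∧-comm (lookup X u) (lookup X v)) Xs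

  invertAll-coverParity : (Xs : List (Subset n)) (D : Digraph n) (u v : Fin n) →
                          invertAll Xs D u v ≡ (if coverParity Xs u v then D v u else D u v)
  invertAll-coverParity []       D u v = refl
  invertAll-coverParity (X ∷ Xs) D u v
    rewrite invertAll-coverParity Xs (invert X D) u v | ∧-comm (lookup X v) (lookup X u)
    with lookup X u ∧ lookup X v | coverParity Xs u v
  ... | true  | true  = refl
  ... | true  | false = refl
  ... | false | true  = refl
  ... | false | false = refl

  invertAll-tournament : (Xs : List (Subset n)) {D : Digraph n} → IsTournament D → IsTournament (invertAll Xs D)
  invertAll-tournament Xs {D} (loopless , oneWay) = loopless′ , oneWay′
    where
    loopless′ : ∀ i → invertAll Xs D i i ≡ false
    loopless′ i rewrite invertAll-coverParity Xs D i i with coverParity Xs i i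
    ... | true  = loopless i
    ... | false = loopless i
    D′ = invertAll Xs D
    oneWay′ : ∀ i j → i ≢ j → (D′ i j ≡ true × D′ j i ≡ false) ⊎ (D′ i j ≡ false × D′ j i ≡ true)
    oneWay′ i j i≢j rewrite invertAll-coverParity Xs D i j | invertAll-coverParity Xs D j i
      | coverParity-sym Xs j i with coverParity Xs i j | oneWay i j i≢j
    ... | false | edge = edge
    ... | true  | inj₁ (ij , ji) = inj₂ (ji , ij)
    ... | true  | inj₂ (ij , ji) = inj₁ (ji , ij)

  rank : Permutation′ n → Fin n → ℕ
  rank π i = toℕ (π ⟨$⟩ʳ i)

  rank-injective : (π : Permutation′ n) {i j : Fin n} → rank π i ≡ rank π j → i ≡ j
  rank-injective π {i} {j} eq = begin
    i                        ≡⟨ inverseˡ π ⟨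
    π ⟨$⟩ˡ (π ⟨$⟩ʳ i)        ≡⟨ cong (π ⟨$⟩ˡ_) (toℕ-injective eq) ⟩
    π ⟨$⟩ˡ (π ⟨$⟩ʳ j)        ≡⟨ inverseˡ π ⟩
    j                        ∎
    where open ≡-Reasoning

  rank-xor : (π : Permutation′ n) {u v : Fin n} → u ≢ v →
             (rank π u <ᵇ rank π v) xor (rank π v <ᵇ rank π u) ≡ true
  rank-xor π {u} {v} u≢v with <-cmp (rank π u) (rank π v)
  ... | tri< u<v _ v≮u rewrite dec-true (_ <? _) u<v | dec-false (_ <? _) v≮u = refl
  ... | tri≈ _ u=v _   = contradiction (rank-injective π u=v) u≢v
  ... | tri> u≮v _ v<u rewrite dec-false (_ <? _) u≮v | dec-true (_ <? _) v<u = refl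

  Descending : Permutation′ n → Digraph n → Set
  Descending π D = ∀ a b → D a b ≡ true → rank π b ℕ.< rank π a

  descending⇒acyclic : (π : Permutation′ n) {D : Digraph n} → Descending π D → Acyclic D
  descending⇒acyclic π {D} desc i cycle = <-irrefl refl (descends cycle)
    where
    descends : ∀ {a b} → TransClosure (λ x y → D x y ≡ true) a b → rank π b ℕ.< rank π a
    descends [ ab ]      = desc _ _ ab
    descends (ab ∷ walk) = <-trans (descends walk) (desc _ _ ab)

  LEdge-forward : (π : Permutation′ n) (D : Digraph n) {a b : Fin n} →
                  D a b ≡ true → rank π a ℕ.< rank π b → LEdge D π a b ≡ true
  LEdge-forward π D ab a<b rewrite ab | dec-true (_ <? _) a<b = refl

  noLEdges⇒descending : (π : Permutation′ n) {D : Digraph n} → (∀ i → D i i ≡ false) →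
                        (∀ u v → LEdge D π u v ≡ false) → Descending π D
  noLEdges⇒descending π {D} loopless noL a b ab with <-cmp (rank π a) (rank π b)
  ... | tri< a<b _ _ = contradiction (trans (sym (noL a b)) (LEdge-forward π D ab a<b)) λ ()
  ... | tri≈ _ a=b _ rewrite rank-injective π a=b = contradiction (trans (sym ab) (loopless b)) λ ()
  ... | tri> _ _ b<a = b<a

  LEdge-irrefl : (D : Digraph n) (π : Permutation′ n) (u : Fin n) → LEdge D π u u ≡ false
  LEdge-irrefl D π u rewrite dec-false (rank π u <? rank π u) (<-irrefl refl) | ∧-zeroʳ (D u u) = refl

  tournament-xor : {D : Digraph n} → IsTournament D → {u v : Fin n} → u ≢ v → D u v xor D v u ≡ true
  tournament-xor (_ , oneWay) {u} {v} u≢v with oneWay u v u≢v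
  ... | inj₁ (uv , vu) rewrite uv | vu = refl
  ... | inj₂ (uv , vu) rewrite uv | vu = refl

  -- x, y: the two orientations of a pair; p, q: the two rank comparisons.
  swapped-LEdge : ∀ c x y p q → x xor y ≡ true → p xor q ≡ true →
    ((if c then y else x) ∧ p) ∨ ((if c then x else y) ∧ q) ≡ c xor ((x ∧ p) ∨ (y ∧ q))
  swapped-LEdge false x     y     p     q     _  _  = refl
  swapped-LEdge true  true  true  p     q     () _
  swapped-LEdge true  false false p     q     () _
  swapped-LEdge true  x     y     true  true  _  ()
  swapped-LEdge true  x     y     false false _  ()
  swapped-LEdge true  true  false true  false _  _  = refl
  swapped-LEdge true  true  false false true  _  _  = refl
  swapped-LEdge true  false true  true  false _  _  = refl
  swapped-LEdge true  false true  false true  _  _  = refl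

  LEdge-invertAll : (π : Permutation′ n) (Xs : List (Subset n)) {D : Digraph n} → IsTournament D →
                    {u v : Fin n} → u ≢ v →
                    LEdge (invertAll Xs D) π u v ≡ coverParity Xs u v xor LEdge D π u v
  LEdge-invertAll π Xs {D} tour {u} {v} u≢v
    rewrite invertAll-coverParity Xs D u v | invertAll-coverParity Xs D v u | coverParity-sym Xs v u =
    swapped-LEdge (coverParity Xs u v) (D u v) (D v u) _ _ (tournament-xor tour u≢v) (rank-xor π u≢v)

  upEdge : Digraph n → Permutation′ n → Fin n → Fin n → Bool
  upEdge D π i j = (toℕ i <ᵇ toℕ j) ∧ LEdge D π i j

  lSuccessors : Digraph n → Permutation′ n → Fin n → List (Fin n)
  lSuccessors D π i = filterᵇ (upEdge D π i) (allFin _)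

  upEdge-xor : (D : Digraph n) (π : Permutation′ n) {u v : Fin n} → u ≢ v →
               upEdge D π u v xor upEdge D π v u ≡ LEdge D π u v
  upEdge-xor D π {u} {v} u≢v with <-cmp (toℕ u) (toℕ v)
  ... | tri< u<v _ v≮u rewrite dec-true (_ <? _) u<v | dec-false (_ <? _) v≮u = xor-identityʳ _
  ... | tri≈ _ u=v _   = contradiction (toℕ-injective u=v) u≢v
  ... | tri> u≮v _ v<u rewrite dec-false (_ <? _) u≮v | dec-true (_ <? _) v<u = ∨-comm (D v u ∧ (rank π v <ᵇ rank π u)) _

  numLEdges-lSuccessors : (D : Digraph n) (π : Permutation′ n) →
                          numLEdges D π ≡ sum (map (λ i → length (lSuccessors D π i)) (allFin n))
  numLEdges-lSuccessors D π =
    cong sum (map-cong (λ i → sym (length-filterᵇ (upEdge D π i) (allFin _))) (allFin _))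

  allFin-increasing : Linked Fin._<_ (allFin n)
  allFin-increasing = AllPairs⇒Linked (tabulate⁺-< (λ i<j → i<j))

  lSuccessors-increasing : (D : Digraph n) (π : Permutation′ n) (i : Fin n) → Linked Fin._<_ (lSuccessors D π i)
  lSuccessors-increasing D π i = Linked-filter⁺ (T? ∘ upEdge D π i) <ᶠ-trans allFin-increasing

  lSuccessors-LEdge : (D : Digraph n) (π : Permutation′ n) (i : Fin n) →
                      All (λ j → LEdge D π i j ≡ true) (lSuccessors D π i)
  lSuccessors-LEdge D π i = All.map (λ {j} → T-∧ʳ {toℕ i <ᵇ toℕ j}) (all-filter (T? ∘ upEdge D π i) (allFin _))
    where
    T-∧ʳ : ∀ {x y} → T (x ∧ y) → y ≡ true
    T-∧ʳ {true} {true} _ = refl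

  xorSum-lSuccessors : (D : Digraph n) (π : Permutation′ n) (u v : Fin n) →
                       xorSum (v =ᵇ_) (lSuccessors D π u) ≡ upEdge D π u v
  xorSum-lSuccessors D π u v = begin
    xorSum (v =ᵇ_) (lSuccessors D π u)                       ≡⟨ xorSum-filterᵇ (upEdge D π u) (v =ᵇ_) (allFin _) ⟩
    xorSum (λ j → upEdge D π u j ∧ (v =ᵇ j)) (allFin _)      ≡⟨ xorSum-cong (λ j → ∧-comm (upEdge D π u j) _) (allFin _) ⟩
    xorSum (λ j → (v =ᵇ j) ∧ upEdge D π u j) (allFin _)      ≡⟨ xorSum-indicator v (upEdge D π u) ⟩
    upEdge D π u v                                           ∎
    where open ≡-Reasoning

  module Cherries (blk : Fin n → ℕ) where

    cherries : Fin n → List (Fin n) → List (Subset n)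
    cherries i []          = []
    cherries i (a ∷ [])    = ⁅ i ⁆ ∪ ⁅ a ⁆ ∷ []
    cherries i (a ∷ b ∷ r) = if blk a ℕ.≡ᵇ blk b
      then ⁅ i ⁆ ∪ ⁅ a ⁆ ∪ ⁅ b ⁆ ∷ cherries i r
      else ⁅ i ⁆ ∪ ⁅ a ⁆ ∷ cherries i (b ∷ r)

    module _ (i : Fin n) (P : List (Fin n) → List (Subset n) → Set) (nil : P [] [])
             (one : ∀ a → P (a ∷ []) (⁅ i ⁆ ∪ ⁅ a ⁆ ∷ []))
             (same : ∀ {a b r} → blk a ≡ blk b → P r (cherries i r) →
                     P (a ∷ b ∷ r) (⁅ i ⁆ ∪ ⁅ a ⁆ ∪ ⁅ b ⁆ ∷ cherries i r))
             (diff : ∀ {a b r} → blk a ≢ blk b → P (b ∷ r) (cherries i (b ∷ r)) →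
                     P (a ∷ b ∷ r) (⁅ i ⁆ ∪ ⁅ a ⁆ ∷ cherries i (b ∷ r)))
             where

      cherries-ind : (l : List (Fin n)) → P l (cherries i l)
      cherries-ind []          = nil
      cherries-ind (a ∷ [])    = one a
      cherries-ind (a ∷ b ∷ r) = step (cherries-ind r) (cherries-ind (b ∷ r))
        where
        step : P r (cherries i r) → P (b ∷ r) (cherries i (b ∷ r)) → P (a ∷ b ∷ r) (cherries i (a ∷ b ∷ r))
        step p-r p-b∷r with blk a ℕ.≡ᵇ blk b in blk-a=b
        ... | true  = same (≡ᵇ≡true⇒≡ blk-a=b) p-r
        ... | false = diff (≡ᵇ≡false⇒≢ blk-a=b) p-b∷r

    cherrySets : Digraph n → Permutation′ n → List (Subset n)
    cherrySets D π = concatMap (λ i → cherries i (lSuccessors D π i)) (allFin n)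

    module _ {u v : Fin n} (blk-u≢v : blk u ≢ blk v) where

      private
        u≢v : u ≢ v
        u≢v u≡v = blk-u≢v (cong blk u≡v)

      covers-sameBlock : {a b : Fin n} → blk a ≡ blk b → covers (⁅ a ⁆ ∪ ⁅ b ⁆) u v ≡ false
      covers-sameBlock {a} {b} blk-a≡b = trans (covers-pair u≢v a b) (cong₂ _xor_
        (=ᵇ∧=ᵇ≡false {u = u} {a} {v} {b} λ { refl refl → blk-u≢v blk-a≡b })
        (=ᵇ∧=ᵇ≡false {u = v} {a} {u} {b} λ { refl refl → blk-u≢v (sym blk-a≡b) }))

      coverParity-cherries : (i : Fin n) (l : List (Fin n)) → Linked Fin._<_ l →
                             coverParity (cherries i l) u v ≡ xorSum (λ a → samePair i a u v) l
      coverParity-cherries i = cherries-ind i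
        (λ l Xs → Linked Fin._<_ l → coverParity Xs u v ≡ xorSum (λ a → samePair i a u v) l)
        (λ _ → refl)
        (λ a _ → cong (_xor false) (covers-pair u≢v i a))
        (λ {a} {b} blk-a≡b ih a∷b∷r↑ → trans
          (cong₂ _xor_ (covers-triple u≢v i (λ { refl → <-irrefl refl (Linked.head a∷b∷r↑) })
                                            (covers-sameBlock blk-a≡b))
                       (ih (Linked.tail (Linked.tail a∷b∷r↑))))
          (xor-assoc (samePair i a u v) (samePair i b u v) _))
        (λ {a} _ ih a∷b∷r↑ → cong₂ _xor_ (covers-pair u≢v i a) (ih (Linked.tail a∷b∷r↑)))

      coverParity-cherrySets : (D : Digraph n) (π : Permutation′ n) → coverParity (cherrySets D π) u v ≡ LEdge D π u v
      coverParity-cherrySets D π = begin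
        coverParity (cherrySets D π) u v
          ≡⟨ xorSum-concatMap (λ X → covers X u v) (λ i → cherries i (L i)) (allFin n) ⟩
        xorSum (λ i → coverParity (cherries i (L i)) u v) (allFin n)
          ≡⟨ xorSum-cong (λ i → trans (coverParity-cherries i (L i) (lSuccessors-increasing D π i)) (samePair-sum i (L i))) (allFin n) ⟩
        xorSum (λ i → ((u =ᵇ i) ∧ xorSum (v =ᵇ_) (L i)) xor ((v =ᵇ i) ∧ xorSum (u =ᵇ_) (L i))) (allFin n)
          ≡⟨ xorSum-xor (λ i → (u =ᵇ i) ∧ xorSum (v =ᵇ_) (L i)) _ (allFin n) ⟩
        xorSum (λ i → (u =ᵇ i) ∧ xorSum (v =ᵇ_) (L i)) (allFin n) xor xorSum (λ i → (v =ᵇ i) ∧ xorSum (u =ᵇ_) (L i)) (allFin n)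
          ≡⟨ cong₂ _xor_ (xorSum-indicator u (λ i → xorSum (v =ᵇ_) (L i))) (xorSum-indicator v (λ i → xorSum (u =ᵇ_) (L i))) ⟩
        xorSum (v =ᵇ_) (L u) xor xorSum (u =ᵇ_) (L v)
          ≡⟨ cong₂ _xor_ (xorSum-lSuccessors D π u v) (xorSum-lSuccessors D π v u) ⟩
        upEdge D π u v xor upEdge D π v u
          ≡⟨ upEdge-xor D π u≢v ⟩
        LEdge D π u v
          ∎
        where
        open ≡-Reasoning
        L = lSuccessors D π
        samePair-sum : (i : Fin n) (l : List (Fin n)) → xorSum (λ a → samePair i a u v) l
                       ≡ ((u =ᵇ i) ∧ xorSum (v =ᵇ_) l) xor ((v =ᵇ i) ∧ xorSum (u =ᵇ_) l)
        samePair-sum i l = trans (xorSum-xor (λ a → (u =ᵇ i) ∧ (v =ᵇ a)) _ l)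
          (cong₂ _xor_ (xorSum-∧ˡ (u =ᵇ i) (v =ᵇ_) l) (xorSum-∧ˡ (v =ᵇ i) (u =ᵇ_) l))

      LEdge-cherrySets : (D : Digraph n) (π : Permutation′ n) → IsTournament D →
                         LEdge (invertAll (cherrySets D π) D) π u v ≡ false
      LEdge-cherrySets D π tour = begin
        LEdge (invertAll (cherrySets D π) D) π u v             ≡⟨ LEdge-invertAll π (cherrySets D π) tour u≢v ⟩
        coverParity (cherrySets D π) u v xor LEdge D π u v     ≡⟨ cong (_xor LEdge D π u v) (coverParity-cherrySets D π) ⟩
        LEdge D π u v xor LEdge D π u v                        ≡⟨ xor-same (LEdge D π u v) ⟩
        false                                                  ∎
        where open ≡-Reasoning

    cherries-size : (i : Fin n) (l : List (Fin n)) → All (λ X → ∣ X ∣ ≤ 3) (cherries i l)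
    cherries-size i = cherries-ind i (λ _ Xs → All (λ X → ∣ X ∣ ≤ 3) Xs) []
      (λ a → ∣⁅i⁆∪⁅a⁆∣≤3 i a ∷ [])
      (λ {a} {b} _ sizes → ∣⁅i⁆∪⁅a⁆∪⁅b⁆∣≤3 i a b ∷ sizes)
      (λ {a} _ sizes → ∣⁅i⁆∪⁅a⁆∣≤3 i a ∷ sizes)

    cherrySets-size : (D : Digraph n) (π : Permutation′ n) → All (λ X → ∣ X ∣ ≤ 3) (cherrySets D π)
    cherrySets-size D π = concat⁺ (All-map⁺ (All.universal (λ i → cherries-size i (lSuccessors D π i)) (allFin n)))

    length-cherries≤ : (i : Fin n) (l : List (Fin n)) → length (cherries i l) ≤ length l
    length-cherries≤ i = cherries-ind i (λ l Xs → length Xs ≤ length l) z≤n (λ _ → ≤-refl)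
      (λ _ ih → s≤s (m≤n⇒m≤1+n ih)) (λ _ ih → s≤s ih)

    length-cherrySets≤numLEdges : (D : Digraph n) (π : Permutation′ n) → length (cherrySets D π) ≤ numLEdges D π
    length-cherrySets≤numLEdges D π = begin
      length (cherrySets D π)                                     ≡⟨ length-concatMap (λ i → cherries i (L i)) (allFin n) ⟩
      sum (map (λ i → length (cherries i (L i))) (allFin n))      ≤⟨ sum-map-mono (λ i → length-cherries≤ i (L i)) (allFin n) ⟩
      sum (map (λ i → length (L i)) (allFin n))                   ≡⟨ numLEdges-lSuccessors D π ⟨
      numLEdges D π                                               ∎
      where
      open ≤-Reasoning
      L = lSuccessors D π

    module _ (m : ℕ) (blk<m : ∀ a → blk a < m) where

      headBlock : List (Fin n) → ℕ
      headBlock []      = m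
      headBlock (a ∷ _) = blk a

      private
        BlockSorted : List (Fin n) → Set
        BlockSorted = Linked (λ a b → blk a ≤ blk b)

        blk≤headBlock : {b : Fin n} {r : List (Fin n)} → BlockSorted (b ∷ r) → blk b ≤ headBlock r
        blk≤headBlock {b} [-]       = <⇒≤ (blk<m b)
        blk≤headBlock     (b≤c ∷ _) = b≤c

        suc+suc : ∀ c x → ℕ.suc c + ℕ.suc c + x ≡ ℕ.suc (ℕ.suc (c + c + x))
        suc+suc c x = cong (_+ x) (cong ℕ.suc (+-suc c c))

      -- Each singleton cherry is paid for by a change of block along the sorted list.
      length-cherries-blocks : (i : Fin n) (l : List (Fin n)) → BlockSorted l →
                               length (cherries i l) + length (cherries i l) + headBlock l ≤ length l + m
      length-cherries-blocks i = cherries-ind i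
        (λ l Xs → BlockSorted l → length Xs + length Xs + headBlock l ≤ length l + m)
        (λ _ → ≤-refl)
        (λ a _ → s≤s (blk<m a))
        (λ {a} {b} {r} blk-a≡b ih a∷b∷r↑ → let c = length (cherries i r) in begin
          ℕ.suc c + ℕ.suc c + blk a        ≡⟨ suc+suc c (blk a) ⟩
          ℕ.suc (ℕ.suc (c + c + blk a))    ≤⟨ s≤s (s≤s (+-monoʳ-≤ (c + c)
                                               (≤-trans (≤-reflexive blk-a≡b) (blk≤headBlock (Linked.tail a∷b∷r↑))))) ⟩
          ℕ.suc (ℕ.suc (c + c + headBlock r)) ≤⟨ s≤s (s≤s (ih (Linked.tail (Linked.tail a∷b∷r↑)))) ⟩
          ℕ.suc (ℕ.suc (length r + m))     ∎)
        (λ {a} {b} {r} blk-a≢b ih a∷b∷r↑ → let c = length (cherries i (b ∷ r)) in begin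
          ℕ.suc c + ℕ.suc c + blk a        ≡⟨ suc+suc c (blk a) ⟩
          ℕ.suc (ℕ.suc (c + c + blk a))    ≡⟨ cong ℕ.suc (+-suc (c + c) (blk a)) ⟨
          ℕ.suc (c + c + ℕ.suc (blk a))    ≤⟨ s≤s (+-monoʳ-≤ (c + c) (≤∧≢⇒< (Linked.head a∷b∷r↑) blk-a≢b)) ⟩
          ℕ.suc (c + c + blk b)            ≤⟨ s≤s (ih (Linked.tail a∷b∷r↑)) ⟩
          ℕ.suc (ℕ.suc (length r) + m)     ∎)
        where open ≤-Reasoning

      length-cherrySets-blocks : (∀ {a b} → a Fin.< b → blk a ≤ blk b) → (D : Digraph n) (π : Permutation′ n) →
                                 length (cherrySets D π) + length (cherrySets D π) ≤ numLEdges D π + n * m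
      length-cherrySets-blocks blk-mono D π = begin
        length (cherrySets D π) + length (cherrySets D π)
          ≡⟨ cong (λ s → s + s) (length-concatMap (λ i → cherries i (L i)) (allFin n)) ⟩
        sum (map c (allFin n)) + sum (map c (allFin n))
          ≡⟨ sum-map-+ c c (allFin n) ⟨
        sum (map (λ i → c i + c i) (allFin n))
          ≤⟨ sum-map-mono (λ i → ≤-trans (m≤m+n (c i + c i) (headBlock (L i)))
               (length-cherries-blocks i (L i) (Linked.map blk-mono (lSuccessors-increasing D π i)))) (allFin n) ⟩
        sum (map (λ i → length (L i) + m) (allFin n))
          ≡⟨ sum-map-+ (λ i → length (L i)) (λ _ → m) (allFin n) ⟩
        sum (map (λ i → length (L i)) (allFin n)) + sum (map (λ _ → m) (allFin n))
          ≡⟨ cong₂ _+_ (sym (numLEdges-lSuccessors D π))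
                       (trans (sum-map-const m (allFin n)) (cong (_* m) (length-allFin {n}))) ⟩
        numLEdges D π + n * m
          ∎
        where
        open ≤-Reasoning
        L = lSuccessors D π
        c : Fin n → ℕ
        c i = length (cherries i (L i))

    LEdge-cherrySets⇒sameBlock : (D : Digraph n) (π : Permutation′ n) → IsTournament D → {u v : Fin n} →
                                 LEdge (invertAll (cherrySets D π) D) π u v ≡ true → blk u ≡ blk v
    LEdge-cherrySets⇒sameBlock D π tour {u} {v} uv with blk u ℕ.≟ blk v
    ... | yes blk-u≡v = blk-u≡v
    ... | no  blk-u≢v = contradiction (trans (sym uv) (LEdge-cherrySets blk-u≢v D π tour)) λ ()

  m<m/k*k+k : ∀ m k .{{_ : NonZero k}} → m < m / k * k + k
  m<m/k*k+k m k = begin-strict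
    m                  ≡⟨ m≡m%n+[m/n]*n m k ⟩
    m % k + m / k * k  <⟨ +-monoˡ-< (m / k * k) (m%n<n m k) ⟩
    k + m / k * k      ≡⟨ +-comm k (m / k * k) ⟩
    m / k * k + k      ∎
    where open ≤-Reasoning

  numLEdges-sameBlock≤ : (D : Digraph n) (π : Permutation′ n) (k : ℕ) .{{_ : NonZero k}} →
                         (∀ {u v} → LEdge D π u v ≡ true → toℕ u / k ≡ toℕ v / k) → numLEdges D π ≤ n * k
  numLEdges-sameBlock≤ {n} D π k sameBlock = begin
    numLEdges D π                                ≡⟨ numLEdges-lSuccessors D π ⟩
    sum (map (λ i → length (L i)) (allFin n))    ≤⟨ sum-map-mono block≤k (allFin n) ⟩
    sum (map (λ _ → k) (allFin n))               ≡⟨ sum-map-const k (allFin n) ⟩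
    length (allFin n) * k                        ≡⟨ cong (_* k) (length-allFin {n}) ⟩
    n * k                                        ∎
    where
    open ≤-Reasoning
    L = lSuccessors D π
    block≤k : ∀ i → length (L i) ≤ k
    block≤k i = ≤-trans
      (length-increasing≤ toℕ (Linked⇒AllPairs <ᶠ-trans (lSuccessors-increasing D π i))
         (All.map (λ {j} ij → subst (λ b → b * k ≤ toℕ j) (sym (sameBlock ij)) (m/n*n≤m (toℕ j) k))
            (lSuccessors-LEdge D π i))
         (All.map (λ {j} ij → subst (λ b → toℕ j < b * k + k) (sym (sameBlock ij)) (m<m/k*k+k (toℕ j) k))
            (lSuccessors-LEdge D π i)))
      (≤-reflexive (m+n∸m≡n (toℕ i / k * k) k))

  inv₃-by-blocks : (T : Digraph n) → IsTournament T → (π : Permutation′ n) (k : ℕ) .{{_ : NonZero k}} →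
    ∃ λ (Xs : List (Subset n)) → All (λ X → ∣ X ∣ ≤ 3) Xs × Acyclic (invertAll Xs T) ×
      length Xs + length Xs ≤ numLEdges T π + (n * ℕ.suc (n / k) + (n * k + n * k))
  inv₃-by-blocks {n} T tour π k = S₁ ++ S₂ , ++⁺ (Round₁.cherrySets-size T π) (Round₂.cherrySets-size D₁ π) ,
    subst Acyclic (sym (foldl-++ (λ D X → invert X D) T S₁ S₂))
      (descending⇒acyclic π (noLEdges⇒descending π (proj₁ tour₂) noLEdges)) ,
    length-bound
    where
    module Round₁ = Cherries (λ a → toℕ a / k)
    module Round₂ = Cherries toℕ
    S₁ = Round₁.cherrySets T π
    D₁ = invertAll S₁ T
    S₂ = Round₂.cherrySets D₁ π
    D₂ = invertAll S₂ D₁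
    tour₁ = invertAll-tournament S₁ tour
    tour₂ = invertAll-tournament S₂ tour₁

    noLEdges : ∀ u v → LEdge D₂ π u v ≡ false
    noLEdges u v with u ≟ v
    ... | yes refl = LEdge-irrefl D₂ π u
    ... | no  u≢v  = Round₂.LEdge-cherrySets (λ e → u≢v (toℕ-injective e)) D₁ π tour₁

    length-S₁ : length S₁ + length S₁ ≤ numLEdges T π + n * ℕ.suc (n / k)
    length-S₁ = Round₁.length-cherrySets-blocks (ℕ.suc (n / k))
      (λ a → s≤s (/-monoˡ-≤ k (<⇒≤ (toℕ<n a)))) (λ a<b → /-monoˡ-≤ k (<⇒≤ a<b)) T π

    length-S₂ : length S₂ ≤ n * k
    length-S₂ = ≤-trans (Round₂.length-cherrySets≤numLEdges D₁ π)
                        (numLEdges-sameBlock≤ D₁ π k (Round₁.LEdge-cherrySets⇒sameBlock T π tour))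

    length-bound : length (S₁ ++ S₂) + length (S₁ ++ S₂) ≤ numLEdges T π + (n * ℕ.suc (n / k) + (n * k + n * k))
    length-bound = begin
      length (S₁ ++ S₂) + length (S₁ ++ S₂)                    ≡⟨ cong (λ s → s + s) (length-++ S₁) ⟩
      (length S₁ + length S₂) + (length S₁ + length S₂)        ≡⟨ +-interchange (length S₁) (length S₂) _ _ ⟩
      (length S₁ + length S₁) + (length S₂ + length S₂)        ≤⟨ +-mono-≤ length-S₁ (+-mono-≤ length-S₂ length-S₂) ⟩
      (numLEdges T π + n * ℕ.suc (n / k)) + (n * k + n * k)    ≡⟨ +-assoc (numLEdges T π) _ _ ⟩
      numLEdges T π + (n * ℕ.suc (n / k) + (n * k + n * k))    ∎
      where open ≤-Reasoning

  isqrt : ℕ → ℕ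
  isqrt ℕ.zero    = 0
  isqrt (ℕ.suc m) with ℕ.suc (isqrt m) * ℕ.suc (isqrt m) ℕ.≤? ℕ.suc m
  ... | yes _ = ℕ.suc (isqrt m)
  ... | no  _ = isqrt m

  isqrt-spec : (m : ℕ) → isqrt m * isqrt m ≤ m × m < ℕ.suc (isqrt m) * ℕ.suc (isqrt m)
  isqrt-spec ℕ.zero    = z≤n , s≤s z≤n
  isqrt-spec (ℕ.suc m) with ℕ.suc (isqrt m) * ℕ.suc (isqrt m) ℕ.≤? ℕ.suc m | isqrt-spec m
  ... | yes r+1²≤m+1 | (_ , m<r+1²) =
    r+1²≤m+1 , ≤-trans (s≤s m<r+1²) (*-mono-< (n<1+n (ℕ.suc (isqrt m))) (n<1+n (ℕ.suc (isqrt m))))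
  ... | no  r+1²≰m+1 | (r²≤m , _)   = m≤n⇒m≤1+n r²≤m , ≰⇒> r+1²≰m+1

  blockLength : ℕ → ℕ
  blockLength m = ℕ.suc (isqrt m)

  -- n (n/k + 1) pays for the unpaired cherries and n k for the L-edges left inside blocks.
  excess : ℕ → ℕ
  excess m = m * ℕ.suc (m / blockLength m) + m * blockLength m

  inv₃-bound : (T : Digraph n) → IsTournament T → (π : Permutation′ n) →
    ∃ λ (Xs : List (Subset n)) → All (λ X → ∣ X ∣ ≤ 3) Xs × Acyclic (invertAll Xs T) ×
      length Xs + length Xs ≤ numLEdges T π + (excess n + excess n)
  inv₃-bound {n} T tour π with inv₃-by-blocks T tour π (blockLength n)
  ... | Xs , sizes , acyclic , length≤ = Xs , sizes , acyclic ,
    ≤-trans length≤ (+-monoʳ-≤ (numLEdges T π) (spread (n * ℕ.suc (n / blockLength n)) (n * blockLength n)))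
    where
    spread : ∀ a b → a + (b + b) ≤ (a + b) + (a + b)
    spread a b = ≤-trans (+-monoˡ-≤ (b + b) (m≤m+n a a)) (≤-reflexive (+-interchange a a b b))

  excess≤ : (m : ℕ) → excess m ≤ m * blockLength m + m * blockLength m
  excess≤ m = +-monoˡ-≤ (m * blockLength m) (*-monoʳ-≤ m (m<n*o⇒m/o<n (proj₂ (isqrt-spec m))))

  excess*q≤m*m : (q m : ℕ) → 1 ≤ q → (4 * q) * (4 * q) ≤ m → excess m * q ≤ m * m
  excess*q≤m*m q m 1≤q 16q²≤m = begin
    excess m * q                     ≤⟨ *-monoˡ-≤ q (excess≤ m) ⟩
    (m * k + m * k) * q              ≡⟨ factor m r q ⟩
    m * (2 * q + 2 * r * q)          ≤⟨ *-monoʳ-≤ m (+-monoˡ-≤ (2 * r * q) (*-monoˡ-≤ q (*-monoʳ-≤ 2 1≤r))) ⟩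
    m * (2 * r * q + 2 * r * q)      ≡⟨ cong (m *_) (regroup r q) ⟩
    m * (r * (4 * q))                ≤⟨ *-monoʳ-≤ m (≤-trans (*-monoʳ-≤ r 4q≤r) (proj₁ (isqrt-spec m))) ⟩
    m * m                            ∎
    where
    open ≤-Reasoning
    r = isqrt m
    k = blockLength m
    factor : ∀ m r q → (m * ℕ.suc r + m * ℕ.suc r) * q ≡ m * (2 * q + 2 * r * q)
    factor = solve-∀
    regroup : ∀ r q → 2 * r * q + 2 * r * q ≡ r * (4 * q)
    regroup = solve-∀
    4q≤r : 4 * q ≤ r
    4q≤r = ≮⇒≥ λ r<4q → <⇒≱ (≤-trans (proj₂ (isqrt-spec m)) (*-mono-≤ r<4q r<4q)) 16q²≤m
    1≤r : 1 ≤ r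
    1≤r = ≤-trans 1≤q (≤-trans (m≤n*m q 4) 4q≤r)

  ℕtoℚᵘ : ℕ → ℚᵘ
  ℕtoℚᵘ m = mkℚᵘ (ℤ.+ m) 0

  toℚᵘ-ℕtoℚ : (m : ℕ) → toℚᵘ (ℕtoℚ m) ≃ᵘ ℕtoℚᵘ m
  toℚᵘ-ℕtoℚ m = toℚᵘ-fromℚᵘ (ℕtoℚᵘ m)

  ≤-via-toℚᵘ : {p q : ℚ} {p′ q′ : ℚᵘ} → toℚᵘ p ≃ᵘ p′ → toℚᵘ q ≃ᵘ q′ → p′ ≤ᵘ q′ → p ≤ℚ q
  ≤-via-toℚᵘ p≃p′ q≃q′ p′≤q′ = toℚᵘ-cancel-≤ (ℚᵘ.≤-respˡ-≃ (ℚᵘ.≃-sym p≃p′) (ℚᵘ.≤-respʳ-≃ (ℚᵘ.≃-sym q≃q′) p′≤q′))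

  ℕtoℚ-≤-half : (len l g : ℕ) → len + len ≤ l + (g + g) → ℕtoℚ len ≤ℚ ℕtoℚ l *ℚ ½ +ℚ ℕtoℚ g
  ℕtoℚ-≤-half len l g len+len≤ = ≤-via-toℚᵘ (toℚᵘ-ℕtoℚ len)
    (ℚᵘ.≃-trans (toℚᵘ-homo-+ (ℕtoℚ l *ℚ ½) (ℕtoℚ g))
      (ℚᵘ.+-cong (ℚᵘ.≃-trans (toℚᵘ-homo-* (ℕtoℚ l) ½) (ℚᵘ.*-congʳ (toℚᵘ-ℕtoℚ l))) (toℚᵘ-ℕtoℚ g)))
    (*≤* (subst₂ ℤ._≤_ lhs rhs (ℤ.+≤+ len+len≤)))
    where
    lhs : ℤ.+ (len + len) ≡ ℤ.+ len ℤ.* ℤ.+ 2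
    lhs = trans (pos-+ len len) (double (ℤ.+ len))
      where double : ∀ x → x ℤ.+ x ≡ x ℤ.* ℤ.+ 2
            double = ℤ-solve-∀
    rhs : ℤ.+ (l + (g + g)) ≡ ((ℤ.+ l ℤ.* ℤ.+ 1) ℤ.* ℤ.+ 1 ℤ.+ ℤ.+ g ℤ.* ℤ.+ 2) ℤ.* ℤ.+ 1
    rhs = trans (pos-+ l (g + g)) (trans (cong (λ z → ℤ.+ l ℤ.+ z) (pos-+ g g)) (shape (ℤ.+ l) (ℤ.+ g)))
      where shape : ∀ y z → y ℤ.+ (z ℤ.+ z) ≡ ((y ℤ.* ℤ.+ 1) ℤ.* ℤ.+ 1 ℤ.+ z ℤ.* ℤ.+ 2) ℤ.* ℤ.+ 1
            shape = ℤ-solve-∀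

  ℕtoℚ-≤-scaled : (p q : ℕ) .(c : Coprime (ℕ.suc p) (ℕ.suc q)) (x y : ℕ) → x * ℕ.suc q ≤ y →
                  ℕtoℚ x ≤ℚ mkℚ (ℤ.+ ℕ.suc p) q c *ℚ ℕtoℚ y
  ℕtoℚ-≤-scaled p q c x y x*q≤y = ≤-via-toℚᵘ (toℚᵘ-ℕtoℚ x)
    (ℚᵘ.≃-trans (toℚᵘ-homo-* (mkℚ (ℤ.+ ℕ.suc p) q c) (ℕtoℚ y)) (ℚᵘ.*-congˡ (toℚᵘ-ℕtoℚ y)))
    (*≤* (subst₂ ℤ._≤_ lhs rhs (ℤ.+≤+ (≤-trans x*q≤y (m≤n*m y (ℕ.suc p))))))
    where
    lhs : ℤ.+ (x * ℕ.suc q) ≡ ℤ.+ x ℤ.* ℤ.+ ℕ.suc (q * 1)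
    lhs = trans (pos-* x (ℕ.suc q)) (cong (λ d → ℤ.+ x ℤ.* ℤ.+ ℕ.suc d) (sym (*-identityʳ q)))
    rhs : ℤ.+ (ℕ.suc p * y) ≡ (ℤ.+ ℕ.suc p ℤ.* ℤ.+ y) ℤ.* ℤ.+ 1
    rhs = trans (pos-* (ℕ.suc p) y) (sym (ℤ-*-identityʳ _))

  -- ε = (p+1)/(q+1) ≥ 1/(q+1), so it suffices that excess n · (q+1) ≤ n².
  excess-littleO : LittleOSq excess
  excess-littleO (mkℚ (ℤ.+ ℕ.suc p) q c) _ = 4 * ℕ.suc q * (4 * ℕ.suc q) , λ m 16q²≤m →
    ℕtoℚ-≤-scaled p q c (excess m) (m * m) (excess*q≤m*m (ℕ.suc q) m (s≤s z≤n) 16q²≤m)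
  excess-littleO (mkℚ (ℤ.+ ℕ.zero) _ _) ()
  excess-littleO (mkℚ ℤ.-[1+ _ ] _ _) ()

open import Defs
open import Data.Nat using (ℕ; _*_; _≤_)
open import Data.Fin.Subset using (Subset; ∣_∣)
open import Data.Fin.Permutation using (Permutation′)
open import Data.List using (List; length)
open import Data.List.Relation.Unary.All using (All)
open import Data.Product using (∃; _×_)
open import Data.Rational using (ℚ; NonNegative; ½; _+_) renaming (_*_ to _*ℚ_; _≤_ to _≤ℚ_)

open import Data.Product using (_,_)
open import Data.Rational.Properties using (≤-trans; +-monoˡ-≤; *-monoʳ-≤-nonNeg)
open TournamentInversion using (excess; excess-littleO; inv₃-bound; ℕtoℚ-≤-half)

corollary3p2 : ∃ λ (f : ℕ → ℕ) → LittleOSq f ×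
    (∀ (α : ℚ) → NonNegative α → ∀ (n : ℕ) (T : Digraph n) → IsTournament T →
      (π : Permutation′ n) → ℕtoℚ (numLEdges T π) ≤ℚ α *ℚ ℕtoℚ (n * n) →
      ∃ λ (Xs : List (Subset n)) → All (λ X → ∣ X ∣ ≤ 3) Xs × Acyclic (invertAll Xs T) ×
        ℕtoℚ (length Xs) ≤ℚ (α *ℚ ℕtoℚ (n * n)) *ℚ ½ + ℕtoℚ (f n))
corollary3p2 = excess , excess-littleO , λ α _ n T tour π numLEdges≤αn² →
  let Xs , sizes , acyclic , length≤ = inv₃-bound T tour π in
  Xs , sizes , acyclic ,
  ≤-trans (ℕtoℚ-≤-half (length Xs) (numLEdges T π) (excess n) length≤)
          (+-monoˡ-≤ (ℕtoℚ (excess n)) (*-monoʳ-≤-nonNeg ½ numLEdges≤αn²))
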